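{- Let $n\in\mathbb{N}$ and let $\alpha=(a_1,\dots,a_n)$ be a parking function of length $n$. For each $i\in[n]$ let $s_i$ be the spot in which car $i$ parks, and let $\alpha'=(a'_1,\dots,a'_n)$ be the parking rearrangement of $\alpha$, i.e. the $n$-tuple with $a'_{s_i}=a_i$ for all $i\in[n]$. Then $\alpha'$ is a parking function of length $n$ that has the same displacement partition as $\alpha$. Furthermore, $\alpha'$ is parking-ordered, i.e. $a'_i\le i$ for all $i\in[n]$.
   Context: $[n]=\{1,\dots,n\}$. A parking function of length $n$ is $\alpha=(a_1,\dots,a_n)\in[n]^n$ such that, when cars $1,\dots,n$ arrive in order on a one-way street with spots $1,\dots,n$, and car $i$ parks in the first unoccupied spot $\ge a_i$, every car parks (equivalently, the nondecreasing rearrangement $(b_1,\dots,b_n)$ satisfies $b_i\le i$). If car $i$ parks in spot $s_i$, its displacement is $d_i=s_i-a_i$; the displacement vector is $V(\alpha)=(d_1,\dots,d_n)$, the displacement is $D(\alpha)=\sum_i d_i$, and the displacement partition is the integer partition of $D(\alpha)$ formed by the nonzero entries of $V(\alpha)$ in nonincreasing order. The tuple $(s_1,\dots,s_n)$ (a permutation of $[n]$) is the parking outcome of $\alpha$. -}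

module Defs where

open import Data.Nat using (ℕ; zero; suc; _+_; _∸_; _≤_; _≟_)
open import Data.Nat.Properties using (≤-decTotalOrder)
open import Data.Fin using (Fin; toℕ)
open import Data.Vec using (Vec; []; _∷_; lookup; zipWith; toList)
open import Data.List using (List; []; _∷_; filter)
open import Data.List.Membership.DecPropositional _≟_ using (_∈?_)
open import Data.Maybe using (Maybe; just; nothing)
open import Data.Product using (_×_; Σ; ∃)
open import Relation.Binary.PropositionalEquality using (_≡_)
open import Relation.Nullary using (¬_; does)
open import Relation.Nullary.Decidable using (¬?)
open import Data.Bool using (if_then_else_)
import Relation.Binary.Properties.DecTotalOrder as DTO
import Data.List.Sort.MergeSort as MS
open import Data.List.Sort.Base using (SortingAlgorithm)

-- Spots are numbered 1..n.  `firstFree n occ a k` returns the first spot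
-- s with a ≤ s ≤ n not in the list `occ` of occupied spots, searching
-- at most k spots starting at a (fuel k = n + 1 ∸ a suffices).
firstFreeFuel : (occ : List ℕ) → (a : ℕ) → (fuel : ℕ) → Maybe ℕ
firstFreeFuel occ a zero = nothing
firstFreeFuel occ a (suc k) =
  if does (a ∈? occ) then firstFreeFuel occ (suc a) k else just a

firstFree : (n : ℕ) → (occ : List ℕ) → (a : ℕ) → Maybe ℕ
firstFree n occ a = firstFreeFuel occ a (suc n ∸ a)

parkFrom : (n : ℕ) → (occ : List ℕ) → {m : ℕ} → Vec ℕ m → Maybe (Vec ℕ m)
parkFrom n occ [] = just []
parkFrom n occ (a ∷ as) with firstFree n occ a
... | nothing = nothing
... | just s with parkFrom n (s ∷ occ) as
...   | nothing = nothing
...   | just ss = just (s ∷ ss)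

parkingOutcome : (n : ℕ) → Vec ℕ n → Maybe (Vec ℕ n)
parkingOutcome n α = parkFrom n [] α

IsParkingFunction : (n : ℕ) → Vec ℕ n → Set
IsParkingFunction n α =
  ((i : Fin n) → (1 ≤ lookup α i) × (lookup α i ≤ n)) ×
  ∃ (λ s → parkingOutcome n α ≡ just s)

displacementVector : {n : ℕ} → (s α : Vec ℕ n) → Vec ℕ n
displacementVector s α = zipWith _∸_ s α

sortDesc : List ℕ → List ℕ
sortDesc = SortingAlgorithm.sort (MS.mergeSort (DTO.≥-decTotalOrder ≤-decTotalOrder))

partitionOf : {n : ℕ} → Vec ℕ n → List ℕ
partitionOf d = sortDesc (filter (λ x → ¬? (x ≟ 0)) (toList d))

displacementPartition : (n : ℕ) → Vec ℕ n → Maybe (List ℕ)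
displacementPartition n α with parkingOutcome n α
... | nothing = nothing
... | just s = just (partitionOf (displacementVector s α))

-- parking-ordered: a_i ≤ i for all i ∈ [n] (Fin index j is i = j+1)
IsParkingOrdered : (n : ℕ) → Vec ℕ n → Set
IsParkingOrdered n α = (j : Fin n) → lookup α j ≤ suc (toℕ j)

-- α' is the parking rearrangement of α w.r.t. the outcome s:
-- a'_{s_i} = a_i for all i (spot s_i has Fin index s_i - 1)
IsParkingRearrangement : (n : ℕ) → (α s α' : Vec ℕ n) → Set
IsParkingRearrangement n α s α' =
  (i j : Fin n) → suc (toℕ j) ≡ lookup s i → lookup α' j ≡ lookup α i

-- Car i of α parks in a spot s_i ≥ a_i, and distinct cars get distinct spots, so i ↦ s_i
-- is a bijection of [n] and α' is well defined with a'_{s_i} = a_i ≤ s_i.  Under α',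
-- car j prefers a spot ≤ j while cars 1, …, j-1 already fill spots 1, …, j-1, so car j
-- parks in spot j.  Hence the displacement of α' at index s_i is s_i - a_i, the
-- displacement of car i under α: the two displacement vectors are permutations of
-- each other and have the same partition.
module Submission where

open import Defs
open import Data.Nat using (ℕ; zero; suc; _+_; _∸_; _≤_; _<_; z≤n; s≤s)
open import Data.Nat.Properties
open import Data.Fin using (Fin; zero; suc; toℕ; fromℕ<; punchOut)
import Data.Fin.Properties as Finₚ
open import Data.Vec using (Vec; []; _∷_; lookup; toList; tabulate)
open import Data.Vec.Properties as Vecₚ using (lookup∘tabulate)
open import Data.List as List using (allFin)
import Data.List.Properties as Listₚ
open import Data.List.Membership.DecPropositional _≟_ using (_∈?_)
open import Data.List.Membership.Propositional using (_∈_; _∉_)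
open import Data.List.Membership.Propositional.Properties using (∈-tabulate⁺; ∈-allFin)
open import Data.List.Membership.Propositional.Properties.WithK using (unique∧set⇒bag)
open import Data.List.Relation.Unary.Any using (here; there)
open import Data.List.Relation.Unary.Unique.Propositional.Properties using (tabulate⁺; allFin⁺)
open import Data.List.Relation.Binary.BagAndSetEquality using (∼bag⇒↭)
open import Data.List.Relation.Binary.Permutation.Propositional using (_↭_; ↭⇒↭ₛ; ↭ₛ⇒↭; module PermutationReasoning)
import Data.List.Relation.Binary.Permutation.Propositional.Properties as Permₚ
import Data.List.Relation.Binary.Permutation.Setoid as PermSetoid
import Data.List.Relation.Binary.Permutation.Setoid.Properties as PermSetoidₚ
open import Data.List.Relation.Binary.Pointwise using (Pointwise-≡⇒≡)
import Data.List.Relation.Unary.Sorted.TotalOrder.Properties as Sortedₚ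
open import Data.List.Sort.Base using (SortingAlgorithm)
import Data.List.Sort.MergeSort as MergeSort
import Relation.Binary.Properties.DecTotalOrder as DecTotalOrderₚ
open import Relation.Binary.Bundles using (DecTotalOrder)
open import Level using (0ℓ)
open import Data.Maybe using (just; nothing)
open import Data.Product using (∃; _×_; _,_; proj₁; proj₂)
open import Data.Sum using (inj₁; inj₂)
open import Function using (_∘_; id; mk⇔)
open import Function.Definitions using (Injective)
open import Relation.Binary.PropositionalEquality
open import Relation.Nullary using (yes; no; contradiction)
open import Relation.Nullary.Decidable using (¬?)

sortDesc-↭ : ∀ {xs ys} → xs ↭ ys → sortDesc xs ≡ sortDesc ys
sortDesc-↭ {xs} {ys} xs↭ys = Pointwise-≡⇒≡
  (Sortedₚ.↗↭↗⇒≋ (DecTotalOrder.totalOrder ≥-order) (sort-↗ xs) (sort-↗ ys)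
    (↭-trans (sort-↭ₛ xs) (↭-trans (↭⇒↭ₛ xs↭ys) (↭-sym (sort-↭ₛ ys)))))
  where
  ≥-order : DecTotalOrder 0ℓ 0ℓ 0ℓ
  ≥-order = DecTotalOrderₚ.≥-decTotalOrder ≤-decTotalOrder
  open SortingAlgorithm (MergeSort.mergeSort ≥-order)
  open PermSetoid (setoid ℕ)

partitionOf-↭ : ∀ {m n} {u : Vec ℕ m} {v : Vec ℕ n} → toList u ↭ toList v → partitionOf u ≡ partitionOf v
partitionOf-↭ u↭v = sortDesc-↭ (↭ₛ⇒↭ (PermSetoidₚ.filter⁺ (setoid ℕ) (λ x → ¬? (x ≟ 0))
                                        (λ { refl → λ x≢0 → x≢0 }) (↭⇒↭ₛ u↭v)))

injective⇒surjective : ∀ {n} {σ : Fin n → Fin n} → Injective _≡_ _≡_ σ → ∀ k → ∃ λ i → σ i ≡ k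
injective⇒surjective {suc n} {σ} σ-inj k with Finₚ.any? (λ i → σ i Finₚ.≟ k)
... | yes hit = hit
... | no miss =
  let i , j , i<j , punch-eq = Finₚ.pigeonhole (n<1+n n) (λ i → punchOut (σ≢k i))
  in contradiction (σ-inj (Finₚ.punchOut-injective (σ≢k i) (σ≢k j) punch-eq)) (Finₚ.<⇒≢ i<j)
  where
  σ≢k : ∀ i → k ≢ σ i
  σ≢k i k≡σi = miss (i , sym k≡σi)

tabulate-∘-↭ : ∀ {a} {A : Set a} {n} {σ : Fin n → Fin n} → Injective _≡_ _≡_ σ →
               (f : Fin n → A) → List.tabulate (f ∘ σ) ↭ List.tabulate f
tabulate-∘-↭ {n = n} {σ} σ-inj f = subst₂ _↭_ (Listₚ.map-tabulate σ f) (Listₚ.map-tabulate id f)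
  (Permₚ.map⁺ f (∼bag⇒↭ (unique∧set⇒bag (tabulate⁺ σ-inj) (allFin⁺ n) (mk⇔ (λ _ → ∈-allFin _) hit))))
  where
  hit : ∀ {k} → k ∈ allFin n → k ∈ List.tabulate σ
  hit {k} _ with i , refl ← injective⇒surjective σ-inj k = ∈-tabulate⁺ i

firstFreeFuel-sound : ∀ occ a fuel {s} → firstFreeFuel occ a fuel ≡ just s → a ≤ s × s ∉ occ × s < a + fuel
firstFreeFuel-sound occ a (suc k) {s} eq with a ∈? occ
... | no a∉occ with refl ← eq = ≤-refl , a∉occ , m<m+n a (s≤s z≤n)
... | yes _ with firstFreeFuel-sound occ (suc a) k eq
...   | 1+a≤s , s∉occ , s<1+a+k = <⇒≤ 1+a≤s , s∉occ , subst (s <_) (sym (+-suc a k)) s<1+a+k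

firstFreeFuel-skips : ∀ occ {a s} fuel → (∀ x → a ≤ x → x < s → x ∈ occ) → s ∉ occ →
                      a ≤ s → s < a + fuel → firstFreeFuel occ a fuel ≡ just s
firstFreeFuel-skips occ {a} {s} zero _ _ a≤s s<a+0 = contradiction (subst (s <_) (+-identityʳ a) s<a+0) (≤⇒≯ a≤s)
firstFreeFuel-skips occ {a} {s} (suc k) busy s∉occ a≤s s<a+1+k with a ∈? occ | m≤n⇒m<n∨m≡n a≤s
... | yes a∈occ | inj₂ refl = contradiction a∈occ s∉occ
... | yes _     | inj₁ a<s  = firstFreeFuel-skips occ k (λ x 1+a≤x → busy x (<⇒≤ 1+a≤x)) s∉occ a<s
                                (subst (s <_) (+-suc a k) s<a+1+k)
... | no a∉occ  | inj₁ a<s  = contradiction (busy a ≤-refl a<s) a∉occ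
... | no _      | inj₂ refl = refl

firstFree-sound : ∀ n occ {a s} → a ≤ n → firstFree n occ a ≡ just s → a ≤ s × s ≤ n × s ∉ occ
firstFree-sound n occ {a} {s} a≤n eq with firstFreeFuel-sound occ a (suc n ∸ a) eq
... | a≤s , s∉occ , s<fuel-end = a≤s , ≤-pred (subst (s <_) (m+[n∸m]≡n (m≤n⇒m≤1+n a≤n)) s<fuel-end) , s∉occ

firstFree-skips : ∀ n occ {a s} → (∀ x → a ≤ x → x < s → x ∈ occ) → s ∉ occ →
                  a ≤ s → s ≤ n → firstFree n occ a ≡ just s
firstFree-skips n occ {a} {s} busy s∉occ a≤s s≤n = firstFreeFuel-skips occ (suc n ∸ a) busy s∉occ a≤s
  (subst (s <_) (sym (m+[n∸m]≡n (m≤n⇒m≤1+n (≤-trans a≤s s≤n)))) (s≤s s≤n))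

parkFrom-∷⁻ : ∀ n occ a {k} (as : Vec ℕ k) {s ss} → parkFrom n occ (a ∷ as) ≡ just (s ∷ ss) →
              firstFree n occ a ≡ just s × parkFrom n (s List.∷ occ) as ≡ just ss
parkFrom-∷⁻ n occ a as eq with firstFree n occ a
... | nothing with () ← eq
... | just s' with parkFrom n (s' List.∷ occ) as in rest
...   | nothing with () ← eq
...   | just ss' with refl ← eq = refl , rest

parkFrom-∷⁺ : ∀ n occ a {k} (as : Vec ℕ k) {s ss} → firstFree n occ a ≡ just s →
              parkFrom n (s List.∷ occ) as ≡ just ss → parkFrom n occ (a ∷ as) ≡ just (s ∷ ss)
parkFrom-∷⁺ n occ a as first rest rewrite first | rest = refl

parkFrom-∉ : ∀ n occ {k} (as : Vec ℕ k) {ss} → parkFrom n occ as ≡ just ss → ∀ i → lookup ss i ∉ occ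
parkFrom-∉ n occ (a ∷ as) {s ∷ ss} eq zero =
  proj₁ (proj₂ (firstFreeFuel-sound occ a (suc n ∸ a) (proj₁ (parkFrom-∷⁻ n occ a as eq))))
parkFrom-∉ n occ (a ∷ as) {s ∷ ss} eq (suc i) =
  parkFrom-∉ n (s List.∷ occ) as (proj₂ (parkFrom-∷⁻ n occ a as eq)) i ∘ there

parkFrom-between : ∀ n occ {k} (as : Vec ℕ k) {ss} → (∀ i → lookup as i ≤ n) → parkFrom n occ as ≡ just ss →
                   ∀ i → lookup as i ≤ lookup ss i × lookup ss i ≤ n
parkFrom-between n occ (a ∷ as) {s ∷ ss} bounded eq zero =
  let a≤s , s≤n , _ = firstFree-sound n occ (bounded zero) (proj₁ (parkFrom-∷⁻ n occ a as eq)) in a≤s , s≤n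
parkFrom-between n occ (a ∷ as) {s ∷ ss} bounded eq (suc i) =
  parkFrom-between n (s List.∷ occ) as (bounded ∘ suc) (proj₂ (parkFrom-∷⁻ n occ a as eq)) i

parkFrom-injective : ∀ n occ {k} (as : Vec ℕ k) {ss} → parkFrom n occ as ≡ just ss → Injective _≡_ _≡_ (lookup ss)
parkFrom-injective n occ (a ∷ as) {s ∷ ss} eq {zero}  {zero}  _ = refl
parkFrom-injective n occ (a ∷ as) {s ∷ ss} eq {zero}  {suc j} s≡ssⱼ =
  contradiction (here (sym s≡ssⱼ)) (parkFrom-∉ n (s List.∷ occ) as (proj₂ (parkFrom-∷⁻ n occ a as eq)) j)
parkFrom-injective n occ (a ∷ as) {s ∷ ss} eq {suc i} {zero}  ssᵢ≡s =
  contradiction (here ssᵢ≡s) (parkFrom-∉ n (s List.∷ occ) as (proj₂ (parkFrom-∷⁻ n occ a as eq)) i)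
parkFrom-injective n occ (a ∷ as) {s ∷ ss} eq {suc i} {suc j} ssᵢ≡ssⱼ =
  cong suc (parkFrom-injective n (s List.∷ occ) as (proj₂ (parkFrom-∷⁻ n occ a as eq)) ssᵢ≡ssⱼ)

parkFrom-consecutive : ∀ n m occ {k} (as : Vec ℕ k) → m + k ≤ n →
                       (∀ x → x ∈ occ → x ≤ m) → (∀ x → 1 ≤ x → x ≤ m → x ∈ occ) →
                       (∀ i → 1 ≤ lookup as i × lookup as i ≤ suc m + toℕ i) →
                       parkFrom n occ as ≡ just (tabulate (λ i → suc m + toℕ i))
parkFrom-consecutive n m occ [] _ _ _ _ = refl
parkFrom-consecutive n m occ {suc k} (a ∷ as) m+1+k≤n occ≤m ≤m⊆occ prefs =
  trans (parkFrom-∷⁺ n occ a as (firstFree-skips n occ busy 1+m∉occ a≤1+m 1+m≤n) rest)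
        (cong just (cong₂ _∷_ (cong suc (sym (+-identityʳ m)))
                              (Vecₚ.tabulate-cong (λ i → cong suc (sym (+-suc m (toℕ i)))))))
  where
  a≤1+m : a ≤ suc m
  a≤1+m = subst (a ≤_) (cong suc (+-identityʳ m)) (proj₂ (prefs zero))
  1+m≤n : suc m ≤ n
  1+m≤n = ≤-trans (m<m+n m (s≤s z≤n)) m+1+k≤n
  1+m∉occ : suc m ∉ occ
  1+m∉occ 1+m∈occ = 1+n≰n (occ≤m (suc m) 1+m∈occ)
  busy : ∀ x → a ≤ x → x < suc m → x ∈ occ
  busy x a≤x x<1+m = ≤m⊆occ x (≤-trans (proj₁ (prefs zero)) a≤x) (≤-pred x<1+m)
  occ'≤1+m : ∀ x → x ∈ suc m List.∷ occ → x ≤ suc m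
  occ'≤1+m x (here refl) = ≤-refl
  occ'≤1+m x (there x∈occ) = m≤n⇒m≤1+n (occ≤m x x∈occ)
  ≤1+m⊆occ' : ∀ x → 1 ≤ x → x ≤ suc m → x ∈ suc m List.∷ occ
  ≤1+m⊆occ' x 1≤x x≤1+m with m≤n⇒m<n∨m≡n x≤1+m
  ... | inj₁ x<1+m = there (≤m⊆occ x 1≤x (≤-pred x<1+m))
  ... | inj₂ refl = here refl
  rest : parkFrom n (suc m List.∷ occ) as ≡ just (tabulate (λ i → suc (suc m) + toℕ i))
  rest = parkFrom-consecutive n (suc m) (suc m List.∷ occ) as (subst (_≤ n) (+-suc m k) m+1+k≤n)
           occ'≤1+m ≤1+m⊆occ'
           (λ i → proj₁ (prefs (suc i)) , subst (lookup as i ≤_) (cong suc (+-suc m (toℕ i))) (proj₂ (prefs (suc i))))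

displacementPartition-outcome : ∀ {n} {α s : Vec ℕ n} → parkingOutcome n α ≡ just s →
                                displacementPartition n α ≡ just (partitionOf (displacementVector s α))
displacementPartition-outcome {n} {α} outcome with parkingOutcome n α
displacementPartition-outcome refl | just _ = refl

toList-displacementVector : ∀ {n} (s α : Vec ℕ n) →
                            toList (displacementVector s α) ≡ List.tabulate (λ i → lookup s i ∸ lookup α i)
toList-displacementVector []      []      = refl
toList-displacementVector (x ∷ s) (a ∷ α) = cong (x ∸ a List.∷_) (toList-displacementVector s α)

fromSpot : ∀ {n x} → 1 ≤ x → x ≤ n → ∃ λ (j : Fin n) → x ≡ suc (toℕ j)
fromSpot {x = suc t} _ t<n = fromℕ< t<n , cong suc (sym (Finₚ.toℕ-fromℕ< t<n))

module ParkingRearrangement {n} (α s α' : Vec ℕ n) (α-pf : IsParkingFunction n α)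
  (outcome : parkingOutcome n α ≡ just s) (rearrangement : IsParkingRearrangement n α s α') where

  private
    between : ∀ i → lookup α i ≤ lookup s i × lookup s i ≤ n
    between = parkFrom-between n List.[] α (proj₂ ∘ proj₁ α-pf) outcome

    parked : ∀ i → ∃ λ (j : Fin n) → lookup s i ≡ suc (toℕ j)
    parked i = fromSpot (≤-trans (proj₁ (proj₁ α-pf i)) (proj₁ (between i))) (proj₂ (between i))

  spot : Fin n → Fin n
  spot = proj₁ ∘ parked

  s≡spot : ∀ i → lookup s i ≡ suc (toℕ (spot i))
  s≡spot = proj₂ ∘ parked

  spot-injective : Injective _≡_ _≡_ spot
  spot-injective {i} {j} spotᵢ≡spotⱼ = parkFrom-injective n List.[] α outcome
    (trans (s≡spot i) (trans (cong (suc ∘ toℕ) spotᵢ≡spotⱼ) (sym (s≡spot j))))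

  α'∘spot : ∀ i → lookup α' (spot i) ≡ lookup α i
  α'∘spot i = rearrangement i (spot i) (sym (s≡spot i))

  α'-parkingOrdered : IsParkingOrdered n α'
  α'-parkingOrdered j with i , refl ← injective⇒surjective spot-injective j =
    subst₂ _≤_ (sym (α'∘spot i)) (s≡spot i) (proj₁ (between i))

  α'-positive : ∀ j → 1 ≤ lookup α' j
  α'-positive j with i , refl ← injective⇒surjective spot-injective j =
    subst (1 ≤_) (sym (α'∘spot i)) (proj₁ (proj₁ α-pf i))

  α'-outcome : parkingOutcome n α' ≡ just (tabulate (suc ∘ toℕ))
  α'-outcome = parkFrom-consecutive n 0 List.[] α' ≤-refl (λ _ ()) (λ { _ (s≤s _) () })
                 (λ j → α'-positive j , α'-parkingOrdered j)

  α'-parkingFunction : IsParkingFunction n α'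
  α'-parkingFunction = (λ j → α'-positive j , ≤-trans (α'-parkingOrdered j) (Finₚ.toℕ<n j)) , _ , α'-outcome

  displacement-↭ : toList (displacementVector (tabulate (suc ∘ toℕ)) α') ↭ toList (displacementVector s α)
  displacement-↭ = begin
    toList (displacementVector (tabulate (suc ∘ toℕ)) α')
      ≡⟨ toList-displacementVector (tabulate (suc ∘ toℕ)) α' ⟩
    List.tabulate (λ j → lookup (tabulate (suc ∘ toℕ)) j ∸ lookup α' j)
      ≡⟨ Listₚ.tabulate-cong (λ j → cong (_∸ lookup α' j) (lookup∘tabulate (suc ∘ toℕ) j)) ⟩
    List.tabulate d'
      ↭⟨ tabulate-∘-↭ spot-injective d' ⟨
    List.tabulate (d' ∘ spot)
      ≡⟨ Listₚ.tabulate-cong (λ i → cong₂ _∸_ (sym (s≡spot i)) (α'∘spot i)) ⟩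
    List.tabulate (λ i → lookup s i ∸ lookup α i)
      ≡⟨ toList-displacementVector s α ⟨
    toList (displacementVector s α) ∎
    where
    open PermutationReasoning
    d' : Fin n → ℕ
    d' j = suc (toℕ j) ∸ lookup α' j

lemma2p2 : (n : ℕ) (α s α' : Vec ℕ n) →
    IsParkingFunction n α →
    parkingOutcome n α ≡ just s →
    IsParkingRearrangement n α s α' →
    IsParkingFunction n α' ×
    displacementPartition n α' ≡ displacementPartition n α ×
    IsParkingOrdered n α'
lemma2p2 n α s α' α-pf outcome rearrangement =
  α'-parkingFunction , same-partition , α'-parkingOrdered
  where
  open ParkingRearrangement α s α' α-pf outcome rearrangement
  same-partition : displacementPartition n α' ≡ displacementPartition n α
  same-partition = begin
    displacementPartition n α'                                                ≡⟨ displacementPartition-outcome α'-outcome ⟩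
    just (partitionOf (displacementVector (tabulate (suc ∘ toℕ)) α'))         ≡⟨ cong just (partitionOf-↭ displacement-↭) ⟩
    just (partitionOf (displacementVector s α))                              ≡⟨ displacementPartition-outcome outcome ⟨
    displacementPartition n α                                                ∎
    where open ≡-Reasoning
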